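{- For every fixed $\delta$ with $0<\delta<\frac13$ and every sufficiently large $n$, there is a collection of $3\lceil 1/\delta\rceil-2$ caterpillars of size $n$ such that for no $k<(1-\delta)n$ is there a partition $\mathcal{P}\in\mathfrak{Q}_n\cap\mathfrak{P}_{n,k}$ lying in $\mathfrak{P}(T)$ for every caterpillar $T$ of the collection. In other words, for such $n$ and all $1\le k<(1-\delta)n$, $c^{(3\lceil 1/\delta\rceil-2)}_{n,k}=\binom{n}{k-1}$.
   Context: A semilabeled binary tree of size $n$ is a tree all of whose vertices have degree $1$ or $3$, with exactly $n$ leaves labeled bijectively by $[n]=\{1,\dots,n\}$; trees are identified up to label-preserving isomorphism. A caterpillar is such a tree in which deleting all leaves leaves a path. For a tree $T$, $\mathfrak{P}(T)$ is the set of partitions of $[n]$ obtained by deleting some set of edges of $T$ and putting two leaf labels in the same class iff they lie in the same component of the resulting forest (components without leaves ignored). $\mathfrak{P}_{n,k}$ is the set of partitions of $[n]$ into exactly $k$ classes; $\mathfrak{Q}_n$ is the set of partitions of $[n]$ having at least two classes of size at least $2$. $c^{(t)}_{n,k}=\min\left|\bigcap_{i=1}^t\mathfrak{P}(T_i)\cap\mathfrak{P}_{n,k}\right|$ over all choices of $t$ caterpillars $T_1,\dots,T_t$ of size $n$.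
   Formalization: The parameter δ takes only rational values in the interval between 0 and 1/3. -}

module Defs where

open import Data.Nat using (ℕ; zero; suc; _+_; _*_; _∸_; _/_; _⊓_; _<_; NonZero; s≤s)
open import Data.Nat.Properties using (m⊓n≤n)
open import Data.Fin using (Fin; toℕ; fromℕ<; inject₁; suc)
open import Data.Fin.Permutation using (Permutation′; _⟨$⟩ʳ_)
open import Data.Sum using (_⊎_; inj₁; inj₂)
open import Data.Product using (_×_; _,_; proj₁; proj₂; Σ; ∃-syntax)
open import Data.Bool using (Bool; false)
open import Relation.Binary.PropositionalEquality using (_≡_; _≢_)
open import Function.Bundles using (_⇔_)

⌈_/_⌉ : ℕ → (p : ℕ) → .{{NonZero p}} → ℕ
⌈ q / p ⌉ = (q + p ∸ 1) / p

-- Caterpillars of size n = 3 + m.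
-- A caterpillar is given by its leaf order σ (a permutation of [n]):
-- internal (degree-3) vertices v₀,…,vₘ form the spine path v₀ - v₁ - … - vₘ,
-- the leaves in positions 0,1 hang on v₀, the leaf in position p (2 ≤ p ≤ m)
-- hangs on v_{p-1}, and the leaves in positions m+1, m+2 hang on vₘ.
-- Every caterpillar of size n ≥ 3 arises this way.

record Caterpillar (m : ℕ) : Set where
  constructor caterpillar
  field
    order : Permutation′ (3 + m)

-- vertices: leaves (labelled by Fin n) ⊎ internal spine vertices
Vertex : ℕ → Set
Vertex m = Fin (3 + m) ⊎ Fin (suc m)

-- edges: one pendant edge per leaf position ⊎ spine edges vⱼ - vⱼ₊₁
Edge : ℕ → Set
Edge m = Fin (3 + m) ⊎ Fin m

attach : ∀ {m} → Fin (3 + m) → Fin (suc m)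
attach {m} p = fromℕ< {(toℕ p ∸ 1) ⊓ m} (s≤s (m⊓n≤n (toℕ p ∸ 1) m))

ends : ∀ {m} → Caterpillar m → Edge m → Vertex m × Vertex m
ends T (inj₁ p) = inj₁ (Caterpillar.order T ⟨$⟩ʳ p) , inj₂ (attach p)
ends T (inj₂ j) = inj₂ (inject₁ j) , inj₂ (suc j)

data Reach {V E : Set} (en : E → V × V) (kept : E → Set) : V → V → Set where
  stay  : ∀ {v} → Reach en kept v v
  stepˡ : ∀ {w} (e : E) → kept e → Reach en kept (proj₂ (en e)) w → Reach en kept (proj₁ (en e)) w
  stepʳ : ∀ {w} (e : E) → kept e → Reach en kept (proj₁ (en e)) w → Reach en kept (proj₂ (en e)) w

-- Partitions of [n] into exactly k classes are represented by surjective
-- class-assignments f : Fin n → Fin k (the partition is the kernel of f).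

Surj : ∀ {n k} → (Fin n → Fin k) → Set
Surj {n} {k} f = ∀ (b : Fin k) → ∃[ a ] f a ≡ b

InQ : ∀ {n k} → (Fin n → Fin k) → Set
InQ {n} f = ∃[ a ] ∃[ b ] ∃[ c ] ∃[ d ]
  (a ≢ b × f a ≡ f b × c ≢ d × f c ≡ f d × f a ≢ f c)

-- 𝔓(T) : the partition (kernel of f) arises by deleting a set D of edges of T
-- (D e ≡ true means e is deleted), two leaf labels being in the same class
-- iff the corresponding leaves are in the same component.
InP : ∀ {m k} → Caterpillar m → (Fin (3 + m) → Fin k) → Set
InP {m} T f = Σ (Edge m → Bool) λ D →
  ∀ (i j : Fin (3 + m)) →
    (f i ≡ f j) ⇔ Reach (ends T) (λ e → D e ≡ false) (inj₁ i) (inj₁ j)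

-- In a caterpillar the leaves of a component hang on a segment of the spine, so two
-- classes of size ≥ 2 of a partition in 𝔓(T) never interleave in the leaf order of T.
-- With r = ⌈q/p⌉ ≥ 1/δ, take the identity order, the order listing the residue classes
-- mod r one after another, and its r − 1 cyclic rotations of the classes.  A class
-- meeting two residues would interleave with another class of size ≥ 2 in one of
-- these orders, so all members of a class are congruent mod r, hence ≥ r apart.
-- Noninterleaving in the identity order then lets each block of r consecutive labels
-- contain at most one label that is not the last of its class, giving
-- n ≤ k + (n − 1)/r, i.e. k ≥ (1 − δ)n.

module Submission where

open import Defs
open import Data.Bool using (false)
open import Data.Bool.Properties using (T-≡)
open import Data.Empty using (⊥; ⊥-elim)
open import Data.Fin using (Fin; zero; suc; toℕ; fromℕ<; punchOut; join; splitAt)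
open import Data.Fin.Properties
  using (toℕ-fromℕ<; toℕ-inject₁; toℕ-injective; toℕ<n; fromℕ<-injective; any?; punchOut-injective; injective⇒≤; splitAt-join)
  renaming (_≟_ to _≟ᶠ_)
open import Data.Fin.Permutation using (Permutation′; permutation; _⟨$⟩ʳ_; _⟨$⟩ˡ_; inverseˡ)
open import Data.Fin.Subset using (Subset; _∈_; _⊂_; ∣_∣)
open import Data.Fin.Subset.Properties using (p⊂q⇒∣p∣<∣q∣; ∣⊤∣≡n; ∈⊤)
open import Data.Nat
  using (ℕ; zero; suc; _+_; _*_; _∸_; _<_; _≤_; _<ᵇ_; _≤?_; _<?_; z≤n; s≤s; s≤s⁻¹; _/_; _%_; NonZero; >-nonZero; >-nonZero⁻¹)
open import Data.Nat.DivMod using (m≡m%n+[m/n]*n; m%n<n; m/n*n≤m; m*n/n≡m; /-monoˡ-≤; m/n≡1+[m∸n]/n)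
open import Data.Nat.Properties
open import Data.Product using (Σ; _×_; _,_; proj₁; proj₂; ∃-syntax)
open import Data.Sum using (_⊎_; inj₁; inj₂)
open import Data.Sum.Properties using (inj₁-injective; inj₂-injective)
open import Data.Vec using (tabulate)
open import Data.Vec.Properties using (lookup∘tabulate; []=⇒lookup; lookup⇒[]=)
open import Function.Base using (_∘_)
open import Function.Bundles using (Equivalence)
open import Function.Definitions using (Injective)
open import Relation.Binary.Definitions using (tri<; tri≈; tri>)
open import Relation.Binary.PropositionalEquality
open import Relation.Nullary using (¬_; Dec; yes; no)
open import Relation.Nullary.Decidable using (_×-dec_)

module _ {V E : Set} {ends : E → V × V} {kept : E → Set} where

  Reach-trans : ∀ {u v w} → Reach ends kept u v → Reach ends kept v w → Reach ends kept u w
  Reach-trans stay          r = r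
  Reach-trans (stepˡ e k q) r = stepˡ e k (Reach-trans q r)
  Reach-trans (stepʳ e k q) r = stepʳ e k (Reach-trans q r)

  Reach-sym : ∀ {u v} → Reach ends kept u v → Reach ends kept v u
  Reach-sym stay          = stay
  Reach-sym (stepˡ e k r) = Reach-trans (Reach-sym r) (stepʳ e k stay)
  Reach-sym (stepʳ e k r) = Reach-trans (Reach-sym r) (stepˡ e k stay)

position : ∀ {m} → Caterpillar m → Fin (3 + m) → Fin (3 + m)
position T x = Caterpillar.order T ⟨$⟩ˡ x

attach-mono : ∀ {m} {p p' : Fin (3 + m)} → toℕ p ≤ toℕ p' → toℕ (attach {m} p) ≤ toℕ (attach {m} p')
attach-mono {m} {p} {p'} p≤p'
  rewrite toℕ-fromℕ< (s≤s (m⊓n≤n (toℕ p ∸ 1) m)) | toℕ-fromℕ< (s≤s (m⊓n≤n (toℕ p' ∸ 1) m))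
  = ⊓-monoˡ-≤ m (∸-monoˡ-≤ 1 p≤p')

module Spine {m : ℕ} (T : Caterpillar m) (kept : Edge m → Set) where

  open Caterpillar T

  _~_ : Vertex m → Vertex m → Set
  _~_ = Reach (ends T) kept

  height : Vertex m → ℕ
  height (inj₁ x) = toℕ (attach {m} (position T x))
  height (inj₂ j) = toℕ j

  height-label : ∀ p → height (inj₁ (order ⟨$⟩ʳ p)) ≡ toℕ (attach {m} p)
  height-label p = cong (toℕ ∘ attach {m}) (inverseˡ order)

  reach-height : ∀ {v w} → v ~ w → (c : ℕ) → height v < c → c ≤ height w →
                 ∃[ j ] toℕ j ≡ c × v ~ inj₂ j
  reach-height stay c v<c c≤w = ⊥-elim (<⇒≱ v<c c≤w)
  reach-height (stepˡ (inj₁ p) k r) c v<c c≤w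
    with j , j≡c , r' ← reach-height r c (subst (_< c) (height-label p) v<c) c≤w
    = j , j≡c , stepˡ (inj₁ p) k r'
  reach-height (stepʳ (inj₁ p) k r) c v<c c≤w
    with j , j≡c , r' ← reach-height r c (subst (_< c) (sym (height-label p)) v<c) c≤w
    = j , j≡c , stepʳ (inj₁ p) k r'
  reach-height (stepˡ (inj₂ j) k r) c v<c c≤w
    with m≤n⇒m<n∨m≡n (subst (λ h → suc h ≤ c) (toℕ-inject₁ j) v<c)
  ... | inj₂ 1+j≡c = suc j , 1+j≡c , stepˡ (inj₂ j) k stay
  ... | inj₁ 1+j<c with j' , j'≡c , r' ← reach-height r c 1+j<c c≤w
    = j' , j'≡c , stepˡ (inj₂ j) k r'
  reach-height (stepʳ (inj₂ j) k r) c v<c c≤w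
    with j' , j'≡c , r' ← reach-height r c (<-trans (≤-reflexive (cong suc (toℕ-inject₁ j))) v<c) c≤w
    = j' , j'≡c , stepʳ (inj₂ j) k r'

  leaf-reaches-attachment : ∀ {x w} → inj₁ x ~ w → inj₁ x ≢ w → inj₁ x ~ inj₂ (attach {m} (position T x))
  leaf-reaches-attachment r = first-step r refl
    where
    first-step : ∀ {v w x} → v ~ w → v ≡ inj₁ x → v ≢ w → inj₁ x ~ inj₂ (attach {m} (position T x))
    first-step stay                  _    v≢w = ⊥-elim (v≢w refl)
    first-step (stepˡ (inj₁ p) k _)  refl _   =
      subst (λ q → inj₁ (order ⟨$⟩ʳ p) ~ inj₂ (attach {m} q)) (sym (inverseˡ order)) (stepˡ (inj₁ p) k stay)
    first-step (stepˡ (inj₂ _) _ _) ()   _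
    first-step (stepʳ (inj₁ _) _ _) ()   _
    first-step (stepʳ (inj₂ _) _ _) ()   _

Noninterleaving : ∀ {n k} → (Fin n → Fin k) → (Fin n → ℕ) → Set
Noninterleaving {n} f key = ∀ (a a' b b' : Fin n) → f a ≡ f a' → f b ≡ f b' → b ≢ b' → f a ≢ f b →
  key a < key b → key b < key a' → ⊥

-- The component of b leaves b (as b ≢ b'), so it contains b's spine vertex, which
-- lies between the spine vertices of a and a' and is therefore met by the path from a to a'.
InP⇒noninterleaving : ∀ {m k} (T : Caterpillar m) (f : Fin (3 + m) → Fin k) → InP T f →
                      Noninterleaving f (toℕ ∘ position T)
InP⇒noninterleaving {m} T f (D , components) a a' b b' fa≡fa' fb≡fb' b≢b' fa≢fb a<b b<a' =
  fa≢fb (Equivalence.from (components a b) (Reach-trans a~attach-b (Reach-sym b~attach-b)))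
  where
  open Spine T (λ e → D e ≡ false)

  connected : ∀ {x y} → f x ≡ f y → inj₁ x ~ inj₁ y
  connected {x} {y} = Equivalence.to (components x y)

  inj₁-≢ : ∀ {x y} → x ≢ y → inj₁ x ≢ inj₁ y
  inj₁-≢ x≢y refl = x≢y refl

  a≢a' : a ≢ a'
  a≢a' refl = <-asym a<b b<a'

  b~attach-b : inj₁ b ~ inj₂ (attach {m} (position T b))
  b~attach-b = leaf-reaches-attachment (connected fb≡fb') (inj₁-≢ b≢b')

  a~attach-b : inj₁ a ~ inj₂ (attach {m} (position T b))
  a~attach-b with m≤n⇒m<n∨m≡n (attach-mono {m} (<⇒≤ a<b))
  ... | inj₂ same = subst (λ j → inj₁ a ~ inj₂ j) (toℕ-injective same)
                      (leaf-reaches-attachment (connected fa≡fa') (inj₁-≢ a≢a'))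
  ... | inj₁ below with j , j≡b , a~j ← reach-height (connected fa≡fa') _ below (attach-mono {m} (<⇒≤ b<a'))
    = subst (λ j → inj₁ a ~ inj₂ j) (toℕ-injective j≡b) a~j

injective⇒surjective : ∀ {n} {g : Fin n → Fin n} → Injective _≡_ _≡_ g → ∀ y → ∃[ x ] g x ≡ y
injective⇒surjective {suc n} {g} g-inj y with any? (λ x → g x ≟ᶠ y)
... | yes hit = hit
... | no miss = ⊥-elim (<-irrefl refl (injective⇒≤ punchOut-y∘g-injective))
  where
  punchOut-y∘g : Fin (suc n) → Fin n
  punchOut-y∘g x = punchOut {i = y} {j = g x} (λ y≡gx → miss (x , sym y≡gx))

  punchOut-y∘g-injective : Injective _≡_ _≡_ punchOut-y∘g
  punchOut-y∘g-injective {x} {x'} = g-inj ∘ punchOut-injective {i = y} _ _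

injective⇒permutation : ∀ {n} (g : Fin n → Fin n) → Injective _≡_ _≡_ g → Permutation′ n
injective⇒permutation g g-inj =
  permutation (proj₁ ∘ surj) g (λ x → g-inj (proj₂ (surj (g x)))) (proj₂ ∘ surj)
  where surj = injective⇒surjective g-inj

module SortBy {n : ℕ} (key : Fin n → ℕ) (key-inj : Injective _≡_ _≡_ key) where

  below : Fin n → Subset n
  below x = tabulate (λ y → key y <ᵇ key x)

  ∈-below⇒< : ∀ {x y} → y ∈ below x → key y < key x
  ∈-below⇒< {x} {y} y∈ = <ᵇ⇒< (key y) (key x)
    (Equivalence.from T-≡ (trans (sym (lookup∘tabulate _ y)) ([]=⇒lookup y∈)))

  <⇒∈-below : ∀ {x y} → key y < key x → y ∈ below x
  <⇒∈-below {x} {y} y<x = lookup⇒[]= y _ (trans (lookup∘tabulate _ y) (Equivalence.to T-≡ (<⇒<ᵇ y<x)))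

  below-⊂ : ∀ {x y} → key x < key y → below x ⊂ below y
  below-⊂ x<y = (λ z∈ → <⇒∈-below (<-trans (∈-below⇒< z∈) x<y)) , _ , <⇒∈-below x<y , λ x∈ → <-irrefl refl (∈-below⇒< x∈)

  ∣below∣<n : ∀ x → ∣ below x ∣ < n
  ∣below∣<n x = subst (∣ below x ∣ <_) (∣⊤∣≡n n)
    (p⊂q⇒∣p∣<∣q∣ ((λ _ → ∈⊤) , x , ∈⊤ , λ x∈ → <-irrefl refl (∈-below⇒< x∈)))

  rank : Fin n → Fin n
  rank x = fromℕ< (∣below∣<n x)

  rank-mono : ∀ {x y} → key x < key y → toℕ (rank x) < toℕ (rank y)
  rank-mono {x} {y} x<y rewrite toℕ-fromℕ< (∣below∣<n x) | toℕ-fromℕ< (∣below∣<n y) =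
    p⊂q⇒∣p∣<∣q∣ (below-⊂ x<y)

  rank-injective : Injective _≡_ _≡_ rank
  rank-injective {x} {y} rx≡ry with <-cmp (key x) (key y)
  ... | tri< x<y _ _ = ⊥-elim (<-irrefl (cong toℕ rx≡ry) (rank-mono x<y))
  ... | tri≈ _ x≡y _ = key-inj x≡y
  ... | tri> _ _ y<x = ⊥-elim (<-irrefl (cong toℕ (sym rx≡ry)) (rank-mono y<x))

caterpillarBy : ∀ {m} (key : Fin (3 + m) → ℕ) → Injective _≡_ _≡_ key → Caterpillar m
caterpillarBy key key-inj = caterpillar (injective⇒permutation rank rank-injective)
  where open SortBy key key-inj

InP-caterpillarBy⇒noninterleaving : ∀ {m k} (key : Fin (3 + m) → ℕ) (key-inj : Injective _≡_ _≡_ key)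
  (f : Fin (3 + m) → Fin k) → InP (caterpillarBy key key-inj) f → Noninterleaving f key
InP-caterpillarBy⇒noninterleaving key key-inj f inP a a' b b' fa≡fa' fb≡fb' b≢b' fa≢fb a<b b<a' =
  InP⇒noninterleaving _ f inP a a' b b' fa≡fa' fb≡fb' b≢b' fa≢fb (rank-mono a<b) (rank-mono b<a')
  where open SortBy key key-inj

m%n≡o%n⇒m<o⇒m+n≤o : ∀ {m o} n .{{_ : NonZero n}} → m % n ≡ o % n → m < o → m + n ≤ o
m%n≡o%n⇒m<o⇒m+n≤o {m} {o} n m%n≡o%n m<o = begin
    m + n                 ≡⟨ cong (_+ n) (m≡m%n+[m/n]*n m n) ⟩
    m % n + m / n * n + n ≡⟨ +-assoc (m % n) (m / n * n) n ⟩
    m % n + (m / n * n + n) ≡⟨ cong (m % n +_) (+-comm (m / n * n) n) ⟩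
    m % n + suc (m / n) * n ≤⟨ +-mono-≤ (≤-reflexive m%n≡o%n) (*-monoˡ-≤ n m/n<o/n) ⟩
    o % n + o / n * n     ≡⟨ sym (m≡m%n+[m/n]*n o n) ⟩
    o                     ∎
  where
  open ≤-Reasoning
  m/n<o/n : m / n < o / n
  m/n<o/n = *-cancelʳ-< n (m / n) (o / n) (+-cancelˡ-< (o % n) (m / n * n) (o / n * n)
    (subst₂ _<_ (trans (m≡m%n+[m/n]*n m n) (cong (_+ m / n * n) m%n≡o%n)) (m≡m%n+[m/n]*n o n) m<o))

m/n≡o/n⇒o<m+n : ∀ {m o} n .{{_ : NonZero n}} → m / n ≡ o / n → o < m + n
m/n≡o/n⇒o<m+n {m} {o} n m/n≡o/n = begin-strict
    o                 ≡⟨ m≡m%n+[m/n]*n o n ⟩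
    o % n + o / n * n <⟨ +-monoˡ-< (o / n * n) (m%n<n o n) ⟩
    n + o / n * n     ≡⟨ cong (λ d → n + d * n) (sym m/n≡o/n) ⟩
    n + m / n * n     ≤⟨ +-monoʳ-≤ n (m/n*n≤m m n) ⟩
    n + m             ≡⟨ +-comm n m ⟩
    m + n             ∎
  where open ≤-Reasoning

m+n≤o<p⇒m/n<[p∸1]/n : ∀ {m o p} n .{{_ : NonZero n}} → m + n ≤ o → o < p → m / n < (p ∸ 1) / n
m+n≤o<p⇒m/n<[p∸1]/n {m} {o} {suc p} n m+n≤o o<p = begin-strict
    m / n                 ≡⟨ cong (_/ n) (sym (m+n∸n≡m m n)) ⟩
    (m + n ∸ n) / n       <⟨ n<1+n _ ⟩
    suc ((m + n ∸ n) / n) ≡⟨ sym (m/n≡1+[m∸n]/n (m≤n+m n m)) ⟩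
    (m + n) / n           ≤⟨ /-monoˡ-≤ n (≤-trans m+n≤o (s≤s⁻¹ o<p)) ⟩
    p / n                 ∎
  where open ≤-Reasoning

q≤⌈q/p⌉*p : ∀ p q .{{_ : NonZero p}} → q ≤ ⌈ q / p ⌉ * p
q≤⌈q/p⌉*p p@(suc p-1) q = +-cancelʳ-≤ p-1 q (⌈ q / p ⌉ * p) (s≤s⁻¹ (begin
    suc (q + p-1)                         ≡⟨ cong suc (sym (+-∸-assoc q {p} {1} (s≤s z≤n))) ⟩
    suc (q + p ∸ 1)                       ≡⟨ cong suc (m≡m%n+[m/n]*n (q + p ∸ 1) p) ⟩
    suc ((q + p ∸ 1) % p + ⌈ q / p ⌉ * p) ≤⟨ +-monoˡ-≤ (⌈ q / p ⌉ * p) (m%n<n (q + p ∸ 1) p) ⟩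
    p + ⌈ q / p ⌉ * p                     ≡⟨ +-comm p _ ⟩
    ⌈ q / p ⌉ * p + p                     ≡⟨ +-suc _ p-1 ⟩
    suc (⌈ q / p ⌉ * p + p-1)             ∎))
  where open ≤-Reasoning

3p<q⇒2≤⌈q/p⌉ : ∀ p q .{{_ : NonZero p}} → 3 * p < q → 2 ≤ ⌈ q / p ⌉
3p<q⇒2≤⌈q/p⌉ p@(suc p-1) q 3p<q = begin
    2               ≡⟨ sym (m*n/n≡m 2 p) ⟩
    2 * p / p       ≤⟨ /-monoˡ-≤ p 2p≤q+p∸1 ⟩
    (q + p ∸ 1) / p ∎
  where
  open ≤-Reasoning
  2p≤q+p∸1 : 2 * p ≤ q + p ∸ 1
  2p≤q+p∸1 = begin
    2 * p     ≤⟨ *-monoˡ-≤ p {2} {3} (s≤s (s≤s z≤n)) ⟩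
    3 * p     ≤⟨ <⇒≤ 3p<q ⟩
    q         ≤⟨ m≤m+n q p-1 ⟩
    q + p-1   ≡⟨ sym (+-∸-assoc q {p} {1} (s≤s z≤n)) ⟩
    q + p ∸ 1 ∎

-- The hypothesis says k < (1 − δ)(1 + n) for δ = p/q, and q ≤ r p says δ ≥ 1/r.
k+n/r<1+n : ∀ p q r k n .{{_ : NonZero p}} .{{_ : NonZero r}} → q ≤ r * p →
            k * q + p * suc n < q * suc n → k + n / r < suc n
k+n/r<1+n p q r k n q≤rp few with k + n / r <? suc n
... | yes fits = fits
... | no ¬fits = ⊥-elim (<-asym pN<qd qd<pN)
  where
  open ≤-Reasoning
  N = suc n
  k<N : k < N
  k<N with k <? N
  ... | yes k<N = k<N
  ... | no k≮N = ⊥-elim (<⇒≱ few (begin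
          q * N         ≤⟨ *-monoʳ-≤ q (≮⇒≥ k≮N) ⟩
          q * k         ≡⟨ *-comm q k ⟩
          k * q         ≤⟨ m≤m+n (k * q) (p * N) ⟩
          k * q + p * N ∎))
  d = N ∸ k
  d≤n/r : d ≤ n / r
  d≤n/r = m≤n+o⇒m∸n≤o N k (≮⇒≥ ¬fits)
  qd<pN : q * d < p * N
  qd<pN = begin-strict
    q * d         ≤⟨ *-monoˡ-≤ d q≤rp ⟩
    r * p * d     ≡⟨ cong (_* d) (*-comm r p) ⟩
    p * r * d     ≡⟨ *-assoc p r d ⟩
    p * (r * d)   ≡⟨ cong (p *_) (*-comm r d) ⟩
    p * (d * r)   ≤⟨ *-monoʳ-≤ p (*-monoˡ-≤ r d≤n/r) ⟩
    p * (n / r * r) ≤⟨ *-monoʳ-≤ p (m/n*n≤m n r) ⟩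
    p * n         <⟨ *-monoʳ-< p (n<1+n n) ⟩
    p * N         ∎
  pN<qd : p * N < q * d
  pN<qd = +-cancelˡ-< (k * q) (p * N) (q * d) (begin-strict
    k * q + p * N <⟨ few ⟩
    q * N         ≡⟨ cong (q *_) (sym (m+[n∸m]≡n (<⇒≤ k<N))) ⟩
    q * (k + d)   ≡⟨ *-distribˡ-+ q k d ⟩
    q * k + q * d ≡⟨ cong (_+ q * d) (*-comm q k) ⟩
    k * q + q * d ∎)

ClassesSpread : ∀ {n k} → ℕ → (Fin n → Fin k) → Set
ClassesSpread {n} r f = ∀ (x z : Fin n) → f x ≡ f z → toℕ x < toℕ z → toℕ x + r ≤ toℕ z

join-injective : ∀ m n → Injective _≡_ _≡_ (join m n)
join-injective m n {i} {j} eq = trans (sym (splitAt-join m n i)) (trans (cong (splitAt m) eq) (splitAt-join m n j))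

-- Tag the last label of each class by its class and any other label x by its block
-- x / r.  Two such labels x < y of one block cannot share a class (y - x < r), and
-- otherwise x < y < z for a later classmate z of x, as z - x ≥ r.
n≤k+[n∸1]/r : ∀ {n k} r .{{_ : NonZero r}} (f : Fin n → Fin k) →
              ClassesSpread r f → Noninterleaving f toℕ → n ≤ k + (n ∸ 1) / r
n≤k+[n∸1]/r {n} {k} r f spread noninterleaving = injective⇒≤ {f = join k W ∘ tag} (tag-injective ∘ join-injective k W)
  where
  W = (n ∸ 1) / r

  HasLater : Fin n → Set
  HasLater x = ∃[ z ] toℕ x < toℕ z × f z ≡ f x

  hasLater? : ∀ x → Dec (HasLater x)
  hasLater? x = any? (λ z → (toℕ x <? toℕ z) ×-dec (f z ≟ᶠ f x))

  block< : ∀ {x} → HasLater x → toℕ x / r < W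
  block< {x} (z , x<z , fz≡fx) = m+n≤o<p⇒m/n<[p∸1]/n r (spread x z (sym fz≡fx) x<z) (toℕ<n z)

  tag : Fin n → Fin k ⊎ Fin W
  tag x with hasLater? x
  ... | no _       = inj₁ (f x)
  ... | yes later  = inj₂ (fromℕ< (block< later))

  lastOfClass-injective : ∀ {x y} → f x ≡ f y → ¬ HasLater x → ¬ HasLater y → x ≡ y
  lastOfClass-injective {x} {y} fx≡fy ¬lx ¬ly with <-cmp (toℕ x) (toℕ y)
  ... | tri< x<y _ _ = ⊥-elim (¬lx (y , x<y , sym fx≡fy))
  ... | tri≈ _ x≡y _ = toℕ-injective x≡y
  ... | tri> _ _ y<x = ⊥-elim (¬ly (x , y<x , fx≡fy))

  sameBlock⇒¬HasLater : ∀ {x y} → toℕ x < toℕ y → toℕ x / r ≡ toℕ y / r → HasLater x → HasLater y → ⊥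
  sameBlock⇒¬HasLater {x} {y} x<y sameBlock (z , x<z , fz≡fx) (z' , y<z' , fz'≡fy) with f x ≟ᶠ f y
  ... | yes fx≡fy = <⇒≱ (m/n≡o/n⇒o<m+n r sameBlock) (spread x y fx≡fy x<y)
  ... | no fx≢fy  = noninterleaving x z y z' (sym fz≡fx) (sym fz'≡fy) (λ y≡z' → <-irrefl (cong toℕ y≡z') y<z')
                      fx≢fy x<y (<-≤-trans (m/n≡o/n⇒o<m+n r sameBlock) (spread x z (sym fz≡fx) x<z))

  tag-injective : Injective _≡_ _≡_ tag
  tag-injective {x} {y} with hasLater? x | hasLater? y
  ... | no ¬lx | no ¬ly = λ eq → lastOfClass-injective (inj₁-injective eq) ¬lx ¬ly
  ... | no _   | yes _  = λ ()
  ... | yes _  | no _   = λ ()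
  ... | yes lx | yes ly = λ eq → sameBlock-injective (fromℕ<-injective _ _ (block< lx) (block< ly) (inj₂-injective eq)) lx ly
    where
    sameBlock-injective : toℕ x / r ≡ toℕ y / r → HasLater x → HasLater y → x ≡ y
    sameBlock-injective sameBlock lx ly with <-cmp (toℕ x) (toℕ y)
    ... | tri< x<y _ _ = ⊥-elim (sameBlock⇒¬HasLater x<y sameBlock lx ly)
    ... | tri≈ _ x≡y _ = toℕ-injective x≡y
    ... | tri> _ _ y<x = ⊥-elim (sameBlock⇒¬HasLater y<x (sym sameBlock) ly lx)

Noninterleaving-resp-≗ : ∀ {n k} (f : Fin n → Fin k) {key key' : Fin n → ℕ} → (∀ x → key x ≡ key' x) →
                         Noninterleaving f key → Noninterleaving f key'
Noninterleaving-resp-≗ f key≗key' noninterleaving a a' b b' fa≡fa' fb≡fb' b≢b' fa≢fb a<b b<a' =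
  noninterleaving a a' b b' fa≡fa' fb≡fb' b≢b' fa≢fb
    (subst₂ _<_ (sym (key≗key' a)) (sym (key≗key' b)) a<b) (subst₂ _<_ (sym (key≗key' b)) (sym (key≗key' a')) b<a')

InQ⇒otherPair : ∀ {n k} {f : Fin n → Fin k} → InQ f → ∀ a → ∃[ b ] ∃[ b' ] b ≢ b' × f b ≡ f b' × f a ≢ f b
InQ⇒otherPair {f = f} (c , c' , d , d' , c≢c' , fc≡fc' , d≢d' , fd≡fd' , fc≢fd) a with f a ≟ᶠ f c
... | yes fa≡fc = d , d' , d≢d' , fd≡fd' , λ fa≡fd → fc≢fd (trans (sym fa≡fc) fa≡fd)
... | no fa≢fc  = c , c' , c≢c' , fc≡fc' , fa≢fc

module ResidueOrder (n r : ℕ) .{{_ : NonZero r}} where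

  residue : Fin n → ℕ
  residue x = toℕ x % r

  -- Sorting by base lists the residue classes mod r one after another.
  base : Fin n → ℕ
  base x = toℕ x + n * residue x

  base<n*[1+residue] : ∀ x → base x < n * suc (residue x)
  base<n*[1+residue] x = subst (base x <_) (sym (*-suc n (residue x))) (+-monoˡ-< _ (toℕ<n x))

  n*s≤base : ∀ x {s} → s ≤ residue x → n * s ≤ base x
  n*s≤base x s≤res = ≤-trans (*-monoʳ-≤ n s≤res) (m≤n+m _ (toℕ x))

  residue<⇒base< : ∀ {x y} → residue x < residue y → base x < base y
  residue<⇒base< {x} {y} res<res = <-≤-trans (base<n*[1+residue] x) (n*s≤base y res<res)

  base<n*r : ∀ x → base x < n * r
  base<n*r x = <-≤-trans (base<n*[1+residue] x) (*-monoʳ-≤ n (m%n<n (toℕ x) r))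

  base-injective : Injective _≡_ _≡_ base
  base-injective {x} {y} bx≡by with <-cmp (residue x) (residue y)
  ... | tri< lt _ _ = ⊥-elim (<-irrefl bx≡by (residue<⇒base< lt))
  ... | tri> _ _ gt = ⊥-elim (<-irrefl (sym bx≡by) (residue<⇒base< gt))
  ... | tri≈ _ rx≡ry _ = toℕ-injective (+-cancelʳ-≡ _ (toℕ x) (toℕ y) (trans bx≡by (cong (λ ρ → toℕ y + n * ρ) (sym rx≡ry))))

  -- rotated s moves the residue classes below s behind all others.
  rotated : ℕ → Fin n → ℕ
  rotated s x with s ≤? residue x
  ... | yes _ = base x
  ... | no _  = base x + n * r

  rotated-≥ : ∀ {s x} → s ≤ residue x → rotated s x ≡ base x
  rotated-≥ {s} {x} s≤res with s ≤? residue x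
  ... | yes _    = refl
  ... | no s≰res = ⊥-elim (s≰res s≤res)

  rotated-< : ∀ {s x} → ¬ s ≤ residue x → rotated s x ≡ base x + n * r
  rotated-< {s} {x} s≰res with s ≤? residue x
  ... | yes s≤res = ⊥-elim (s≰res s≤res)
  ... | no _      = refl

  rotated-injective : ∀ s → Injective _≡_ _≡_ (rotated s)
  rotated-injective s {x} {y} with s ≤? residue x | s ≤? residue y
  ... | yes _ | yes _ = base-injective
  ... | no _  | no _  = base-injective ∘ +-cancelʳ-≡ (n * r) (base x) (base y)
  ... | yes _ | no _  = λ eq → ⊥-elim (<-irrefl eq (<-≤-trans (base<n*r x) (m≤n+m (n * r) (base y))))
  ... | no _  | yes _ = λ eq → ⊥-elim (<-irrefl (sym eq) (<-≤-trans (base<n*r y) (m≤n+m (n * r) (base x))))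

  module _ {k} (f : Fin n → Fin k) (base-noninterleaving : Noninterleaving f base) where

    -- Whichever side of s the other class lies on, it is interleaved either in the
    -- base order or in the rotated one.
    straddle⇒⊥ : ∀ {s} → Noninterleaving f (rotated s) → ∀ a a' b b' → residue a < s → s ≤ residue a' →
                 f a ≡ f a' → f b ≡ f b' → b ≢ b' → f a ≢ f b → ⊥
    straddle⇒⊥ {s} rotated-noninterleaving a a' b b' a<s s≤a' fa≡fa' fb≡fb' b≢b' fa≢fb with s ≤? residue b
    ... | yes s≤b with <-cmp (base b) (base a')
    ...   | tri< b<a' _ _ = base-noninterleaving a a' b b' fa≡fa' fb≡fb' b≢b' fa≢fb (residue<⇒base< (<-≤-trans a<s s≤b)) b<a'
    ...   | tri≈ _ b≡a' _ = fa≢fb (trans fa≡fa' (cong f (sym (base-injective b≡a'))))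
    ...   | tri> _ _ a'<b = rotated-noninterleaving a' a b b' (sym fa≡fa') fb≡fb' b≢b' (λ fa'≡fb → fa≢fb (trans fa≡fa' fa'≡fb))
              (subst₂ _<_ (sym (rotated-≥ s≤a')) (sym (rotated-≥ s≤b)) a'<b)
              (subst₂ _<_ (sym (rotated-≥ s≤b)) (sym (rotated-< (<⇒≱ a<s))) (<-≤-trans (base<n*r b) (m≤n+m (n * r) (base a))))
    straddle⇒⊥ {s} rotated-noninterleaving a a' b b' a<s s≤a' fa≡fa' fb≡fb' b≢b' fa≢fb | no s≰b with <-cmp (base b) (base a)
    ...   | tri> _ _ a<b = base-noninterleaving a a' b b' fa≡fa' fb≡fb' b≢b' fa≢fb a<b (residue<⇒base< (<-≤-trans (≰⇒> s≰b) s≤a'))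
    ...   | tri≈ _ b≡a _ = fa≢fb (cong f (sym (base-injective b≡a)))
    ...   | tri< b<a _ _ = rotated-noninterleaving a' a b b' (sym fa≡fa') fb≡fb' b≢b' (λ fa'≡fb → fa≢fb (trans fa≡fa' fa'≡fb))
              (subst₂ _<_ (sym (rotated-≥ s≤a')) (sym (rotated-< s≰b)) (<-≤-trans (base<n*r a') (m≤n+m (n * r) (base b))))
              (subst₂ _<_ (sym (rotated-< s≰b)) (sym (rotated-< (<⇒≱ a<s))) (+-monoˡ-< (n * r) b<a))

    sameClass⇒sameResidue : InQ f → (∀ s → s < r → Noninterleaving f (rotated s)) →
                            ∀ a a' → f a ≡ f a' → residue a ≡ residue a'
    sameClass⇒sameResidue inQ rotated-noninterleaving = sameResidue
      where
      lowerResidue⇒⊥ : ∀ a a' → f a ≡ f a' → residue a < residue a' → ⊥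
      lowerResidue⇒⊥ a a' fa≡fa' a<a' with b , b' , b≢b' , fb≡fb' , fa≢fb ← InQ⇒otherPair inQ a =
        straddle⇒⊥ (rotated-noninterleaving (suc (residue a)) (≤-<-trans a<a' (m%n<n (toℕ a') r)))
          a a' b b' ≤-refl a<a' fa≡fa' fb≡fb' b≢b' fa≢fb

      sameResidue : ∀ a a' → f a ≡ f a' → residue a ≡ residue a'
      sameResidue a a' fa≡fa' with <-cmp (residue a) (residue a')
      ... | tri< a<a' _ _ = ⊥-elim (lowerResidue⇒⊥ a a' fa≡fa' a<a')
      ... | tri≈ _ a≡a' _ = a≡a'
      ... | tri> _ _ a'<a = ⊥-elim (lowerResidue⇒⊥ a' a (sym fa≡fa') a'<a)

  orderKey : ℕ → Fin n → ℕ
  orderKey zero    = toℕ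
  orderKey (suc s) = rotated s

  orderKey-injective : ∀ s → Injective _≡_ _≡_ (orderKey s)
  orderKey-injective zero    = toℕ-injective
  orderKey-injective (suc s) = rotated-injective s

  noninterleaving⇒spread : ∀ {k} (f : Fin n → Fin k) → InQ f → (∀ s → s ≤ r → Noninterleaving f (orderKey s)) →
                           ClassesSpread r f
  noninterleaving⇒spread f inQ noninterleaving x z fx≡fz x<z =
    m%n≡o%n⇒m<o⇒m+n≤o r
      (sameClass⇒sameResidue f
        (Noninterleaving-resp-≗ f (λ y → rotated-≥ z≤n) (noninterleaving 1 (>-nonZero⁻¹ r)))
        inQ (λ s s<r → noninterleaving (suc s) s<r) x z fx≡fz)
      x<z

r<3r∸2 : ∀ r → 2 ≤ r → r < 3 * r ∸ 2
r<3r∸2 r 2≤r = m+n≤o⇒m≤o∸n (suc r) (begin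
    suc r + 2 ≡⟨ +-comm (suc r) 2 ⟩
    3 + r     ≤⟨ +-monoˡ-≤ r (≤-trans (n≤1+n 3) (*-monoʳ-≤ 2 2≤r)) ⟩
    2 * r + r ≡⟨ +-comm (2 * r) r ⟩
    3 * r     ∎)
  where open ≤-Reasoning

module Construction (p q : ℕ) .{{_ : NonZero p}} (3p<q : 3 * p < q) where

  r : ℕ
  r = ⌈ q / p ⌉

  2≤r : 2 ≤ r
  2≤r = 3p<q⇒2≤⌈q/p⌉ p q 3p<q

  instance
    r-nonZero : NonZero r
    r-nonZero = >-nonZero (≤-trans (s≤s z≤n) 2≤r)

  t : ℕ
  t = 3 * r ∸ 2

  module _ (m : ℕ) where

    open ResidueOrder (3 + m) r

    caterpillarAt : ℕ → Caterpillar m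
    caterpillarAt s = caterpillarBy (orderKey s) (orderKey-injective s)

    caterpillars : Fin t → Caterpillar m
    caterpillars i = caterpillarAt (toℕ i)

    fewClasses : ∀ {k} (f : Fin (3 + m) → Fin k) → InQ f → (∀ i → InP (caterpillars i) f) → 3 + m ≤ k + (2 + m) / r
    fewClasses f inQ allInP = n≤k+[n∸1]/r r f (noninterleaving⇒spread f inQ noninterleaving) (noninterleaving 0 z≤n)
      where
      noninterleaving : ∀ s → s ≤ r → Noninterleaving f (orderKey s)
      noninterleaving s s≤r = InP-caterpillarBy⇒noninterleaving (orderKey s) (orderKey-injective s) f
        (subst (λ s → InP (caterpillarAt s) f) (toℕ-fromℕ< s<t) (allInP (fromℕ< s<t)))
        where s<t = ≤-<-trans s≤r (r<3r∸2 r 2≤r)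

theorem7p2 : (p q : ℕ) → .{{_ : NonZero p}} → 3 * p < q →
    ∃[ N ] ((m : ℕ) → N ≤ 3 + m →
      Σ (Fin (3 * ⌈ q / p ⌉ ∸ 2) → Caterpillar m) λ Ts →
        (k : ℕ) → k * q + p * (3 + m) < q * (3 + m) →
          (f : Fin (3 + m) → Fin k) → Surj f → InQ f →
            ¬ ((i : Fin (3 * ⌈ q / p ⌉ ∸ 2)) → InP (Ts i) f))
theorem7p2 p q 3p<q = 0 , λ m _ → caterpillars m , λ k few f _ inQ allInP →
  <⇒≱ (k+n/r<1+n p q r k (2 + m) (q≤⌈q/p⌉*p p q) few) (fewClasses m f inQ allInP)
  where open Construction p q 3p<q
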